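{- Let $F$ be a finite group and $c$ a union of conjugacy classes of $F$. Then every conjugacy class of $\tilde F_c$ whose image in $F$ lies in $c\cup\{1\}$ maps bijectively onto its image in $F$.
   Context: Fix a Schur cover $1\to H_2(F,\mathbb{Z})\to C\to F\to1$; for commuting $x,y\in F$ set $\langle x,y\rangle=[\hat x,\hat y]\in H_2(F,\mathbb{Z})$ with arbitrary lifts $\hat x,\hat y\in C$. $\tilde F_c$ is the quotient of $C$ by the subgroup generated by all $\langle x,y\rangle$ with $x\in c$ and $y$ commuting with $x$; it is a central extension $1\to H_2(F,c)\to\tilde F_c\to F\to 1$, where $H_2(F,c)$ is the corresponding quotient of $H_2(F,\mathbb{Z})$. -}

module Defs where

open import Level using (Level; _⊔_; suc)
open import Algebra.Bundles using (Group)
open import Algebra.Morphism.Structures using (module GroupMorphisms)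
open import Data.Nat using (ℕ)
open import Data.Fin using (Fin)
open import Data.Bool using (Bool; true; false)
open import Data.Product using (Σ; ∃; ∃₂; _×_; _,_; proj₂)
open import Data.Sum using (_⊎_)
open import Data.List using (List; []; _∷_)
open import Data.List.Relation.Unary.All using (All)
open import Relation.Unary using (Pred)

private variable a ℓ b ℓ′ p : Level

module _ (G : Group a ℓ) where
  open Group G

  IsFiniteGroup : Set (a ⊔ ℓ)
  IsFiniteGroup = Σ ℕ λ n → Σ (Fin n → Carrier) λ f → ∀ x → ∃ λ i → f i ≈ x

  conj : Carrier → Carrier → Carrier
  conj g x = (g ∙ x) ∙ g ⁻¹

  comm : Carrier → Carrier → Carrier
  comm x y = ((x ⁻¹ ∙ y ⁻¹) ∙ x) ∙ y

  IsUnionOfConjClasses : Pred Carrier p → Set (a ⊔ ℓ ⊔ p)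
  IsUnionOfConjClasses c =
    (∀ {x y} → x ≈ y → c x → c y) × (∀ g x → c x → c (conj g x))

  evalWord : List (Bool × Carrier) → Carrier
  evalWord [] = ε
  evalWord ((true  , s) ∷ w) = s ∙ evalWord w
  evalWord ((false , s) ∷ w) = s ⁻¹ ∙ evalWord w

  InGenerated : Pred Carrier p → Pred Carrier (a ⊔ ℓ ⊔ p)
  InGenerated S x =
    ∃ λ (w : List (Bool × Carrier)) → All (λ e → S (proj₂ e)) w × evalWord w ≈ x

  InDerived : Pred Carrier (a ⊔ ℓ)
  InDerived = InGenerated (λ z → ∃₂ λ x y → z ≈ comm x y)

record StemExtension (C : Group a ℓ) (F : Group b ℓ′) : Set (a ⊔ ℓ ⊔ b ⊔ ℓ′) where
  private
    module C = Group C
    module F = Group F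
  open GroupMorphisms C.rawGroup F.rawGroup
  field
    π         : C.Carrier → F.Carrier
    isHom     : IsGroupHomomorphism π
    surj      : ∀ y → ∃ λ x → π x F.≈ y
    central   : ∀ z → π z F.≈ F.ε → ∀ g → (z C.∙ g) C.≈ (g C.∙ z)
    kerInDerived : ∀ z → π z F.≈ F.ε → InDerived C z

-- A Schur cover (Schur's "Darstellungsgruppe"): a stem extension whose
-- kernel is of maximal size, i.e. the kernel of every stem extension of F
-- (with carrier in the same universe) injects into it.
record IsSchurCover {C : Group a ℓ} {F : Group b ℓ′} (E : StemExtension C F)
       : Set (suc a ⊔ suc ℓ ⊔ b ⊔ ℓ′) where
  private
    module C = Group C
    module F = Group F
    module E = StemExtension E
  field
    maximal : (C′ : Group a ℓ) (E′ : StemExtension C′ F) →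
      let module C′ = Group C′
          module E′ = StemExtension E′ in
      Σ (Σ C′.Carrier (λ z → E′.π z F.≈ F.ε) → Σ C.Carrier (λ z → E.π z F.≈ F.ε)) λ f →
        ∀ u v → Group._≈_ C (Σ.proj₁ (f u)) (Σ.proj₁ (f v)) → Σ.proj₁ u C′.≈ Σ.proj₁ v

module _ {C : Group a ℓ} {F : Group b ℓ′} (E : StemExtension C F) where
  private
    module C = Group C
    module F = Group F
    open StemExtension E

  -- generators ⟨x , y⟩ = [x̂ , ŷ] with x = π x̂ ∈ c and y = π ŷ commuting with x
  relGen : Pred F.Carrier p → Pred C.Carrier (a ⊔ ℓ ⊔ ℓ′ ⊔ p)
  relGen c z = ∃₂ λ u v → c (π u) × ((π u F.∙ π v) F.≈ (π v F.∙ π u)) × z C.≈ comm C u v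

  -- equality in F̃_c = C / ⟨ ⟨x,y⟩ : x ∈ c, xy = yx ⟩ , as a relation on C
  _≈̃[_]_ : C.Carrier → Pred F.Carrier p → C.Carrier → Set (a ⊔ ℓ ⊔ ℓ′ ⊔ p)
  u ≈̃[ c ] v = InGenerated C (relGen c) (u C.⁻¹ C.∙ v)

{-# OPTIONS --safe #-}
module Submission where

open import Defs
open import Level using (Level)
open import Algebra.Bundles using (Group)
open import Algebra.Morphism.Structures using (module GroupMorphisms)
open import Relation.Unary using (Pred)
open import Data.Sum using (_⊎_; inj₁; inj₂)
open import Data.Product using (_,_)
open import Data.Bool using (true)
open import Data.List using ([]; _∷_)
open import Data.List.Relation.Unary.All using ([]; _∷_)
import Algebra.Properties.Group as GroupProperties
import Relation.Binary.Reasoning.Setoid as SetoidReasoning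

-- Write x = g u g⁻¹, y = h u h⁻¹ and w = g h⁻¹.  Then w⁻¹ x w = y, so
-- x⁻¹ y = [x , w].  If π u ∈ c then π x ∈ c, and π x commutes with π w
-- because conjugating π x by π w gives π y = π x; hence x⁻¹ y is one of
-- the generators ⟨π x , π w⟩ killed in F̃_c.  If π u = 1 then u is central
-- and x = u = y.

module _ {a ℓ : Level} (G : Group a ℓ) where
  open Group G
  open GroupProperties G
  open SetoidReasoning setoid

  conjʳ : Carrier → Carrier → Carrier
  conjʳ w x = (w ⁻¹ ∙ x) ∙ w

  comm≈⁻¹∙conjʳ : ∀ x w → comm G x w ≈ x ⁻¹ ∙ conjʳ w x
  comm≈⁻¹∙conjʳ x w = begin
    ((x ⁻¹ ∙ w ⁻¹) ∙ x) ∙ w  ≈⟨ ∙-congʳ (assoc (x ⁻¹) (w ⁻¹) x) ⟩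
    (x ⁻¹ ∙ (w ⁻¹ ∙ x)) ∙ w  ≈⟨ assoc (x ⁻¹) (w ⁻¹ ∙ x) w ⟩
    x ⁻¹ ∙ conjʳ w x         ∎

  conjʳ-conj : ∀ g h u → conjʳ (g ∙ h ⁻¹) (conj G g u) ≈ conj G h u
  conjʳ-conj g h u = begin
    ((g ∙ h ⁻¹) ⁻¹ ∙ ((g ∙ u) ∙ g ⁻¹)) ∙ (g ∙ h ⁻¹)
      ≈⟨ ∙-congʳ (∙-cong (⁻¹-anti-homo-// g h) (assoc g u (g ⁻¹))) ⟩
    ((h ∙ g ⁻¹) ∙ (g ∙ (u ∙ g ⁻¹))) ∙ (g ∙ h ⁻¹)
      ≈⟨ ∙-congʳ (assoc h (g ⁻¹) (g ∙ (u ∙ g ⁻¹))) ⟩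
    (h ∙ (g ⁻¹ ∙ (g ∙ (u ∙ g ⁻¹)))) ∙ (g ∙ h ⁻¹)
      ≈⟨ ∙-congʳ (∙-congˡ (\\-leftDividesʳ g (u ∙ g ⁻¹))) ⟩
    (h ∙ (u ∙ g ⁻¹)) ∙ (g ∙ h ⁻¹)
      ≈⟨ ∙-congʳ (assoc h u (g ⁻¹)) ⟨
    ((h ∙ u) ∙ g ⁻¹) ∙ (g ∙ h ⁻¹)
      ≈⟨ assoc (h ∙ u) (g ⁻¹) (g ∙ h ⁻¹) ⟩
    (h ∙ u) ∙ (g ⁻¹ ∙ (g ∙ h ⁻¹))
      ≈⟨ ∙-congˡ (\\-leftDividesʳ g (h ⁻¹)) ⟩
    (h ∙ u) ∙ h ⁻¹
      ∎

  conjʳ-fixed⇒commute : ∀ {w x} → conjʳ w x ≈ x → x ∙ w ≈ w ∙ x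
  conjʳ-fixed⇒commute {w} {x} fixed = begin
    x ∙ w                   ≈⟨ \\-leftDividesˡ w (x ∙ w) ⟨
    w ∙ (w ⁻¹ ∙ (x ∙ w))    ≈⟨ ∙-congˡ (assoc (w ⁻¹) x w) ⟨
    w ∙ conjʳ w x           ≈⟨ ∙-congˡ fixed ⟩
    w ∙ x                   ∎

  conj-central : ∀ {z} → (∀ g → z ∙ g ≈ g ∙ z) → ∀ g → conj G g z ≈ z
  conj-central {z} central g = begin
    (g ∙ z) ∙ g ⁻¹  ≈⟨ ∙-congʳ (central g) ⟨
    (z ∙ g) ∙ g ⁻¹  ≈⟨ //-rightDividesʳ g z ⟩
    z               ∎

module _ {a ℓ b ℓ′ : Level} (G : Group a ℓ) (H : Group b ℓ′) where
  private
    module G = Group G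
    module H = Group H
  open GroupMorphisms G.rawGroup H.rawGroup

  module _ {π : G.Carrier → H.Carrier} (isHom : IsGroupHomomorphism π) where
    open IsGroupHomomorphism isHom

    conj-homo : ∀ g x → π (conj G g x) H.≈ conj H (π g) (π x)
    conj-homo g x = H.trans (homo (g G.∙ x) (g G.⁻¹)) (H.∙-cong (homo g x) (⁻¹-homo g))

    conjʳ-homo : ∀ w x → π (conjʳ G w x) H.≈ conjʳ H (π w) (π x)
    conjʳ-homo w x =
      H.trans (homo (w G.⁻¹ G.∙ x) w) (H.∙-congʳ (H.trans (homo (w G.⁻¹) x) (H.∙-congʳ (⁻¹-homo w))))

module _ {a ℓ b ℓ′ p : Level} {C : Group a ℓ} {F : Group b ℓ′} (E : StemExtension C F)
         {c : Pred (Group.Carrier F) p} where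
  open Group C

  ≈⇒≈̃ : ∀ {x y} → x ≈ y → _≈̃[_]_ E x c y
  ≈⇒≈̃ {x} {y} x≈y = [] , [] , sym (trans (∙-congʳ (⁻¹-cong x≈y)) (inverseˡ y))

  relGen⇒≈̃ : ∀ {x y} → relGen E c (x ⁻¹ ∙ y) → _≈̃[_]_ E x c y
  relGen⇒≈̃ gen = ((true , _) ∷ []) , (gen ∷ []) , identityʳ _

lemma3p4 : {a ℓ b ℓ′ p : Level} (F : Group b ℓ′) (C : Group a ℓ) →
    IsFiniteGroup F →
    (E : StemExtension C F) → IsSchurCover E →
    (c : Pred (Group.Carrier F) p) → IsUnionOfConjClasses F c →
    (u : Group.Carrier C) →
    (c (StemExtension.π E u) ⊎ Group._≈_ F (StemExtension.π E u) (Group.ε F)) →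
    (g h : Group.Carrier C) →
    Group._≈_ F (StemExtension.π E (conj C g u)) (StemExtension.π E (conj C h u)) →
    _≈̃[_]_ E (conj C g u) c (conj C h u)
lemma3p4 F C _ E _ c (c-resp-≈ , c-conj) u (inj₁ πu∈c) g h πx≈πy =
  relGen⇒≈̃ E {c = c} (x , w , πx∈c , πx∙πw≈πw∙πx , x⁻¹∙y≈[x,w])
  where
  module C = Group C
  module F = Group F
  open StemExtension E
  open GroupMorphisms.IsGroupHomomorphism isHom using (⟦⟧-cong)
  x w : C.Carrier
  x = conj C g u
  w = g C.∙ h C.⁻¹
  x⁻¹∙y≈[x,w] : x C.⁻¹ C.∙ conj C h u C.≈ comm C x w
  x⁻¹∙y≈[x,w] = C.sym (C.trans (comm≈⁻¹∙conjʳ C x w) (C.∙-congˡ (conjʳ-conj C g h u)))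
  πx∈c : c (π x)
  πx∈c = c-resp-≈ (F.sym (conj-homo C F isHom g u)) (c-conj (π g) (π u) πu∈c)
  πx∙πw≈πw∙πx : π x F.∙ π w F.≈ π w F.∙ π x
  πx∙πw≈πw∙πx = conjʳ-fixed⇒commute F (F.trans (F.sym (conjʳ-homo C F isHom w x))
    (F.trans (⟦⟧-cong (conjʳ-conj C g h u)) (F.sym πx≈πy)))
lemma3p4 F C _ E _ c _ u (inj₂ πu≈ε) g h _ =
  ≈⇒≈̃ E {c = c} (C.trans (conj-central C (central u πu≈ε) g) (C.sym (conj-central C (central u πu≈ε) h)))
  where
  module C = Group C
  open StemExtension E
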